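{- Let $n,k\ge1$, let $D_\pi,D_\sigma\in W(n)$ and let $Y(\pi,\sigma)=(Y_1,Y_2,Y_3,Y_4)$. Then the set $F(D_\pi,D_\sigma,k)$ of $k$-colourings $c\in\mathcal{C}_{n+1,k}$ of $D_\pi$ with $\mathcal{R}(D_\pi,c)=D_\sigma$ satisfies $$F(D_\pi,D_\sigma,k)=\bigcup_{A\subseteq Y_2,\;B\subseteq Y_3}\mathsf{WordEuler}_{n,k}\big(Y_1\cup A,\;(Y_2\cup Y_3)\setminus(A\cup B),\;Y_4\cup B\big),$$ and hence $$f(D_\pi,D_\sigma,k)=\sum_{A\subseteq Y_2,\;B\subseteq Y_3}\mathsf{wordeuler}_{n,k}\big(Y_1\cup A,\;(Y_2\cup Y_3)\setminus(A\cup B),\;Y_4\cup B\big).$$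
   Context: A 4-tuple $(x,y,a,b)$ is an edge from peg $x$ at height $a$ to peg $y$ at height $b$ (height 1 = bottom). $W(n)$ is the set of web diagrams on $n+2$ pegs $D=\{e_i=(i,i+1,x_i,y_{i+1}):1\le i\le n+1\}$ with $x_1=y_{n+2}=1$ and $\{x_i,y_i\}=\{1,2\}$ for $2\le i\le n+1$ (peg $i$, $2\le i\le n+1$, carries the right end of $e_{i-1}$ at height $y_i$ and the left end of $e_i$ at height $x_i$). $D$ is encoded by $\pi\in\{+1,-1\}^n$ with $\pi(i)=+1$ if $y_{i+1}=1,x_{i+1}=2$ and $\pi(i)=-1$ if $y_{i+1}=2,x_{i+1}=1$; write $D_\pi$. Reconstruction: $D\oplus D'=D\cup\{(x',y',a'+p_{x'}(D),b'+p_{y'}(D)):(x',y',a',b')\in D'\}$ with $p_i(D)$ the number of endpoints of $D$ on peg $i$; $\mathrm{rel}(X)$ relabels heights of endpoints of edges of $X$ on each peg by $1,\dots,\ell_i$ preserving relative order; a $k$-colouring of $D_\pi$ is $c\in\mathcal{C}_{n+1,k}$ (the set of sequences $(c(1),\dots,c(n+1))$ with $\{c(1),\dots,c(n+1)\}=\{1,\dots,k\}$), edge $e_i$ getting colour $c(i)$, and $\mathcal{R}(D,c)=\mathrm{rel}(D_c(1))\oplus\cdots\oplus\mathrm{rel}(D_c(k))$ with $D_c(t)$ the edges of colour $t$. For $c\in\mathcal{C}_{n+1,k}$: $\mathrm{Des}(c)=\{1\le i\le n:c(i)>c(i+1)\}$, $\mathrm{Equ}(c)=\{1\le i\le n:c(i)=c(i+1)\}$,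 $\mathrm{Asc}(c)=\{1\le i\le n:c(i)<c(i+1)\}$; $\mathsf{WordEuler}_{n,k}(X_1,X_2,X_3)=\{c\in\mathcal{C}_{n+1,k}:(\mathrm{Des}(c),\mathrm{Equ}(c),\mathrm{Asc}(c))=(X_1,X_2,X_3)\}$ and $\mathsf{wordeuler}_{n,k}$ is its cardinality. For $\pi,\sigma\in\{\pm1\}^n$: $Y_1=\{i:\pi_i=+1,\sigma_i=-1\}$, $Y_2=\{i:\pi_i=-1,\sigma_i=-1\}$, $Y_3=\{i:\pi_i=+1,\sigma_i=+1\}$, $Y_4=\{i:\pi_i=-1,\sigma_i=+1\}$ (subsets of $\{1,\dots,n\}$). -}

module Defs where

open import Data.Nat as ℕ using (ℕ; zero; suc; _+_; _<?_)
open import Data.Nat.Properties as ℕP using ()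
open import Data.Fin as Fin using (Fin; inject₁) renaming (suc to fsuc)
open import Data.Fin.Properties as FinP using ()
open import Data.Fin.Subset using (Subset; _⊆_; _∪_; _─_; inside; outside)
open import Data.Fin.Subset.Properties using (_⊆?_)
open import Data.Bool using (Bool; true; false; _∧_)
open import Data.Vec as Vec using (Vec; []; _∷_; lookup; tabulate; toList)
open import Data.Vec.Properties as VecP using ()
open import Data.List as List using (List; []; _∷_; _++_; map; filter; length; foldl; concatMap; cartesianProductWith)
open import Data.Nat.ListAction using (sum)
open import Data.List.Relation.Unary.All using (All; all?)
open import Data.Product using (_×_; _,_; Σ-syntax; ∃-syntax)
open import Data.Product.Properties as ΣP using ()
open import Data.Maybe using (Maybe; just; nothing)
open import Relation.Nullary using (Dec; does; yes; no)
open import Relation.Nullary.Decidable using (_×-dec_)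
open import Relation.Binary.Definitions using (DecidableEquality)
open import Relation.Binary.PropositionalEquality using (_≡_)
import Data.List.Membership.DecPropositional as DecMem

-- An edge (x , y , a , b): from peg x at height a to peg y at height b.
Edge : Set
Edge = ℕ × ℕ × ℕ × ℕ

_≟ᴱ_ : DecidableEquality Edge
_≟ᴱ_ = ΣP.≡-dec ℕP._≟_ (ΣP.≡-dec ℕP._≟_ (ΣP.≡-dec ℕP._≟_ ℕP._≟_))

open DecMem _≟ᴱ_ using (_∈_; _∈?_)

-- A diagram is a finite set of edges, represented by a list.
Diagram : Set
Diagram = List Edge

SameSet : Diagram → Diagram → Set
SameSet D D' = All (_∈ D') D × All (_∈ D) D'

sameSet? : (D D' : Diagram) → Dec (SameSet D D')
sameSet? D D' = all? (_∈? D') D ×-dec all? (_∈? D) D'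

endpoints : Diagram → List (ℕ × ℕ)
endpoints = concatMap (λ { (x , y , a , b) → (x , a) ∷ (y , b) ∷ [] })

pegCount : ℕ → Diagram → ℕ
pegCount i D = length (filter (λ { (q , h) → q ℕP.≟ i }) (endpoints D))

_⊕_ : Diagram → Diagram → Diagram
D ⊕ D' = D ++ map (λ { (x' , y' , a' , b') →
           (x' , y' , a' + pegCount x' D , b' + pegCount y' D) }) D'

-- rel(X): on each peg, an endpoint at height h gets the new height
-- 1 + (number of endpoints of X on that peg strictly below h),
-- i.e. heights are relabelled 1,…,ℓ_i preserving relative order.
rank : Diagram → ℕ → ℕ → ℕ
rank X p h = length (filter (λ { (q , h') → (q ℕP.≟ p) ×-dec (h' <? h) }) (endpoints X))

rel : Diagram → Diagram
rel X = map (λ { (x , y , a , b) → (x , y , suc (rank X x a) , suc (rank X y b)) }) X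

data Sign : Set where
  plus minus : Sign

-- Sign vectors π ∈ {±1}^n as Vec Sign n; π(i) (1-based) = element at index i-1.
nth : {n : ℕ} → Vec Sign n → ℕ → Maybe Sign
nth []       _       = nothing
nth (s ∷ _)  zero    = just s
nth (_ ∷ π)  (suc m) = nth π m

-- x_i : height of the left end of e_i on peg i (x_1 = 1)
xh : {n : ℕ} → Vec Sign n → ℕ → ℕ
xh π (suc (suc m)) with nth π m       -- peg i = m+2, π(i-1) is at index m
... | just plus  = 2
... | just minus = 1
... | nothing    = 1
xh π _ = 1

-- y_i : height of the right end of e_{i-1} on peg i (y_{n+2} = 1)
yh : {n : ℕ} → Vec Sign n → ℕ → ℕ
yh π (suc (suc m)) with nth π m
... | just plus  = 1
... | just minus = 2
... | nothing    = 1
yh π _ = 1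

-- e_i = (i , i+1 , x_i , y_{i+1}), for i = j+1, j : Fin (n+1)
edge : {n : ℕ} → Vec Sign n → Fin (suc n) → Edge
edge π j = (suc (Fin.toℕ j) , suc (suc (Fin.toℕ j)) ,
            xh π (suc (Fin.toℕ j)) , yh π (suc (suc (Fin.toℕ j))))

D : {n : ℕ} → Vec Sign n → Diagram
D {n} π = map (edge π) (List.allFin (suc n))

-- Colourings: colours 1..k are represented by Fin k (order preserved).
-- A colouring c ∈ 𝒞_{n+1,k} is c : Vec (Fin k) (n+1) using every colour.

InC : {m k : ℕ} → Vec (Fin k) m → Set
InC {m} {k} c = All (λ t → t ∈ᶠ toList c) (List.allFin k)
  where open DecMem (FinP._≟_ {k}) renaming (_∈_ to _∈ᶠ_)

inC? : {m k : ℕ} → (c : Vec (Fin k) m) → Dec (InC c)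
inC? {m} {k} c = all? (λ t → t ∈?ᶠ toList c) (List.allFin k)
  where open DecMem (FinP._≟_ {k}) renaming (_∈?_ to _∈?ᶠ_)

colourClass : {n k : ℕ} → Vec Sign n → Vec (Fin k) (suc n) → Fin k → Diagram
colourClass {n} π c t = map (edge π) (filter (λ i → lookup c i FinP.≟ t) (List.allFin (suc n)))

R : {n k : ℕ} → Vec Sign n → Vec (Fin k) (suc n) → Diagram
R {n} {k} π c = foldl (λ acc t → acc ⊕ rel (colourClass π c t)) [] (List.allFin k)

InF : {n k : ℕ} → Vec Sign n → Vec Sign n → Vec (Fin k) (suc n) → Set
InF π σ c = InC c × SameSet (R π c) (D σ)

inF? : {n k : ℕ} (π σ : Vec Sign n) (c : Vec (Fin k) (suc n)) → Dec (InF π σ c)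
inF? π σ c = inC? c ×-dec sameSet? (R π c) (D σ)

-- Des, Equ, Asc as subsets of {1,…,n}; index i : Fin n stands for i+1.

Des Equ Asc : {n k : ℕ} → Vec (Fin k) (suc n) → Subset n
Des c = tabulate (λ i → does (lookup c (fsuc i) FinP.<? lookup c (inject₁ i)))
Equ c = tabulate (λ i → does (lookup c (inject₁ i) FinP.≟ lookup c (fsuc i)))
Asc c = tabulate (λ i → does (lookup c (inject₁ i) FinP.<? lookup c (fsuc i)))

InWordEuler : {n k : ℕ} → Subset n → Subset n → Subset n → Vec (Fin k) (suc n) → Set
InWordEuler X₁ X₂ X₃ c = InC c × Des c ≡ X₁ × Equ c ≡ X₂ × Asc c ≡ X₃

inWordEuler? : {n k : ℕ} (X₁ X₂ X₃ : Subset n) (c : Vec (Fin k) (suc n)) →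
               Dec (InWordEuler X₁ X₂ X₃ c)
inWordEuler? X₁ X₂ X₃ c =
  inC? c ×-dec (VecP.≡-dec Data.Bool._≟_ (Des c) X₁
         ×-dec (VecP.≡-dec Data.Bool._≟_ (Equ c) X₂
         ×-dec  VecP.≡-dec Data.Bool._≟_ (Asc c) X₃))
  where import Data.Bool

allVecs : (k m : ℕ) → List (Vec (Fin k) m)
allVecs k zero    = [] ∷ []
allVecs k (suc m) = cartesianProductWith _∷_ (List.allFin k) (allVecs k m)

allSubsets : (n : ℕ) → List (Subset n)
allSubsets zero    = [] ∷ []
allSubsets (suc n) = cartesianProductWith _∷_ (true ∷ false ∷ []) (allSubsets n)

f : {n : ℕ} → Vec Sign n → Vec Sign n → ℕ → ℕ
f {n} π σ k = length (filter (inF? π σ) (allVecs k (suc n)))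

wordeuler : (n k : ℕ) → Subset n → Subset n → Subset n → ℕ
wordeuler n k X₁ X₂ X₃ = length (filter (inWordEuler? X₁ X₂ X₃) (allVecs k (suc n)))

Y₁f Y₂f Y₃f Y₄f : Sign → Sign → Bool
Y₁f plus  minus = true
Y₁f _     _     = false
Y₂f minus minus = true
Y₂f _     _     = false
Y₃f plus  plus  = true
Y₃f _     _     = false
Y₄f minus plus  = true
Y₄f _     _     = false

Y₁ Y₂ Y₃ Y₄ : {n : ℕ} → Vec Sign n → Vec Sign n → Subset n
Y₁ π σ = tabulate (λ i → Y₁f (lookup π i) (lookup σ i))
Y₂ π σ = tabulate (λ i → Y₂f (lookup π i) (lookup σ i))
Y₃ π σ = tabulate (λ i → Y₃f (lookup π i) (lookup σ i))
Y₄ π σ = tabulate (λ i → Y₄f (lookup π i) (lookup σ i))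

sumWE : {n : ℕ} → Vec Sign n → Vec Sign n → ℕ → ℕ
sumWE {n} π σ k =
  sum (cartesianProductWith
        (λ A B → wordeuler n k (Y₁ π σ ∪ A) ((Y₂ π σ ∪ Y₃ π σ) ─ (A ∪ B)) (Y₄ π σ ∪ B))
        (filter (_⊆? Y₂ π σ) (allSubsets n))
        (filter (_⊆? Y₃ π σ) (allSubsets n)))

module Submission where

-- The heart of the proof is a reconstruction lemma: R(D_π , c) = D_τ, where τ(i) is -1
-- at a descent of c, +1 at an ascent and π(i) at a plateau.
-- First, an invariant of the fold defining R shows that R(D_π , c) consists exactly of
-- the edges of D_π, each endpoint raised by the endpoints of its own colour below it (rel)
-- and by all endpoints of smaller colour on its peg (⊕).  Second, writing these counts as
-- sums over edges, only the neighbouring edge on the same peg contributes, which gives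
-- the new heights in closed form.  So c lies in F iff τ = σ, a condition on each interior
-- peg separately, and peg by peg this is the existence of the decomposition; moreover the
-- parts are forced (A = the descents in Y₂, B = the ascents in Y₃).  This uniqueness turns
-- the characterisation into the counting identity by exchanging finite sums.

open import Defs
open import Data.Bool as Bool using (Bool; true; false; _∧_; _∨_; not; if_then_else_; b≤b; f≤t)
import Data.Bool.Properties as BoolP
open import Data.Fin using (Fin; toℕ; inject₁; fromℕ) renaming (zero to fzero; suc to fsuc)
import Data.Fin.Properties as FinP
open import Data.Fin.Relation.Unary.Top using (View; view; ‵fromℕ; ‵inject₁)
open import Data.Fin.Subset using (Subset; _⊆_; _∪_; _─_)
open import Data.Fin.Subset.Properties using (_⊆?_)
open import Data.List using (List; []; _∷_; _++_; map; filter; length; tabulate; allFin; foldl; cartesianProductWith)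
open import Data.List.Membership.Propositional using (_∈_)
open import Data.List.Membership.Propositional.Properties
  using (∈-map⁺; ∈-map⁻; ∈-++⁺ˡ; ∈-++⁺ʳ; ∈-++⁻; ∈-filter⁺; ∈-filter⁻; ∈-allFin)
import Data.List.Relation.Unary.All as All
open import Data.List.Relation.Unary.Any using (here; there)
open import Data.Maybe using (just; nothing)
open import Data.Nat as ℕ using (ℕ; zero; suc; _+_; _≤_; _≡ᵇ_; _<ᵇ_)
import Data.Nat.Properties as ℕP
open import Data.Nat.ListAction using (sum)
open import Data.Nat.ListAction.Properties using (sum-++)
open import Algebra.Properties.CommutativeSemigroup ℕP.+-commutativeSemigroup using (interchange)
open import Data.Product using (_×_; _,_; proj₁; proj₂; ∃-syntax)
open import Data.Sum using (_⊎_; inj₁; inj₂)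
open import Data.Vec as Vec using (Vec; []; _∷_; lookup)
import Data.Vec.Properties as VecP
open import Data.Vec.Properties using (lookup⇒[]=; []=⇒lookup)
open import Data.Vec.Relation.Binary.Pointwise.Extensional using (ext; Pointwise-≡⇒≡)
open import Function using (_∘_; id)
open import Function.Bundles using (_⇔_; mk⇔; Equivalence)
open import Relation.Binary.Definitions using (DecidableEquality; tri<; tri≈; tri>)
open import Relation.Binary.PropositionalEquality
open import Relation.Nullary using (Dec; does; yes; no)
open import Relation.Nullary.Decidable using (dec-true; dec-false; does-⇔; _×-dec_)
open import Relation.Unary using (Decidable)

∑ : {A : Set} → (A → ℕ) → List A → ℕ
∑ u []       = 0
∑ u (x ∷ xs) = u x + ∑ u xs

𝟙 : Bool → ℕ
𝟙 b = if b then 1 else 0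

when : Bool → ℕ → ℕ
when b v = if b then v else 0

when-zero : ∀ b → when b 0 ≡ 0
when-zero true  = refl
when-zero false = refl

𝟙-∧ : ∀ a b → 𝟙 (a ∧ b) ≡ when a (𝟙 b)
𝟙-∧ true  b = refl
𝟙-∧ false b = refl

≡ᵇ-refl : ∀ m → (m ≡ᵇ m) ≡ true
≡ᵇ-refl m = dec-true (m ℕP.≟ m) refl

≢⇒≡ᵇ-false : ∀ {m n} → m ≢ n → (m ≡ᵇ n) ≡ false
≢⇒≡ᵇ-false {m} {n} m≢n = dec-false (m ℕP.≟ n) m≢n

<ᵇ-irrefl : ∀ m → (m <ᵇ m) ≡ false
<ᵇ-irrefl m = dec-false (m ℕP.<? m) (ℕP.<-irrefl refl)

module _ {A : Set} where

  ∑-++ : (u : A → ℕ) (xs ys : List A) → ∑ u (xs ++ ys) ≡ ∑ u xs + ∑ u ys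
  ∑-++ u []       ys = refl
  ∑-++ u (x ∷ xs) ys = trans (cong (u x +_) (∑-++ u xs ys)) (sym (ℕP.+-assoc (u x) _ _))

  ∑-cong∈ : {u v : A → ℕ} (xs : List A) → (∀ x → x ∈ xs → u x ≡ v x) → ∑ u xs ≡ ∑ v xs
  ∑-cong∈ []       e = refl
  ∑-cong∈ (x ∷ xs) e = cong₂ _+_ (e x (here refl)) (∑-cong∈ xs (λ y y∈xs → e y (there y∈xs)))

  ∑-cong : {u v : A → ℕ} (xs : List A) → (∀ x → u x ≡ v x) → ∑ u xs ≡ ∑ v xs
  ∑-cong xs e = ∑-cong∈ xs (λ x _ → e x)

  ∑-zero : {u : A → ℕ} (xs : List A) → (∀ x → x ∈ xs → u x ≡ 0) → ∑ u xs ≡ 0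
  ∑-zero []       e = refl
  ∑-zero (x ∷ xs) e = cong₂ _+_ (e x (here refl)) (∑-zero xs (λ y y∈xs → e y (there y∈xs)))

  ∑-+ : (u v : A → ℕ) (xs : List A) → ∑ (λ x → u x + v x) xs ≡ ∑ u xs + ∑ v xs
  ∑-+ u v []       = refl
  ∑-+ u v (x ∷ xs) = trans (cong (u x + v x +_) (∑-+ u v xs)) (interchange (u x) (v x) (∑ u xs) (∑ v xs))

  ∑-when : (b : Bool) (u : A → ℕ) (xs : List A) → ∑ (λ x → when b (u x)) xs ≡ when b (∑ u xs)
  ∑-when true  u xs = refl
  ∑-when false u xs = ∑-zero xs (λ _ _ → refl)

  module _ {P : A → Set} (P? : Decidable P) where

    ∑-filter : (u : A → ℕ) (xs : List A) → ∑ u (filter P? xs) ≡ ∑ (λ x → when (does (P? x)) (u x)) xs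
    ∑-filter u []       = refl
    ∑-filter u (x ∷ xs) with does (P? x)
    ... | true  = cong (u x +_) (∑-filter u xs)
    ... | false = ∑-filter u xs

    length-filter : (xs : List A) → length (filter P? xs) ≡ ∑ (λ x → 𝟙 (does (P? x))) xs
    length-filter []       = refl
    length-filter (x ∷ xs) with does (P? x)
    ... | true  = cong suc (length-filter xs)
    ... | false = length-filter xs

∑-map : {A B : Set} (u : B → ℕ) (g : A → B) (xs : List A) → ∑ u (map g xs) ≡ ∑ (u ∘ g) xs
∑-map u g []       = refl
∑-map u g (x ∷ xs) = cong (u (g x) +_) (∑-map u g xs)

∑-swap : {A B : Set} (h : A → B → ℕ) (xs : List A) (ys : List B) →
         ∑ (λ x → ∑ (h x) ys) xs ≡ ∑ (λ y → ∑ (λ x → h x y) xs) ys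
∑-swap h []       ys = sym (∑-zero ys (λ _ _ → refl))
∑-swap h (x ∷ xs) ys = trans (cong (∑ (h x) ys +_) (∑-swap h xs ys))
                              (sym (∑-+ (h x) (λ y → ∑ (λ x → h x y) xs) ys))

∑-tabulate-zero : {A : Set} {m : ℕ} (u : A → ℕ) (g : Fin m → A) →
                  (∀ j → u (g j) ≡ 0) → ∑ u (tabulate g) ≡ 0
∑-tabulate-zero {m = zero}  u g vanish = refl
∑-tabulate-zero {m = suc m} u g vanish = cong₂ _+_ (vanish fzero) (∑-tabulate-zero u (g ∘ fsuc) (vanish ∘ fsuc))

∑-tabulate-point : {A : Set} {m : ℕ} (u : A → ℕ) (g : Fin m → A) (j₀ : Fin m) →
                   (∀ j → j ≢ j₀ → u (g j) ≡ 0) → ∑ u (tabulate g) ≡ u (g j₀)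
∑-tabulate-point u g fzero     vanish =
  trans (cong (u (g fzero) +_) (∑-tabulate-zero u (g ∘ fsuc) (λ j → vanish (fsuc j) (λ ()))))
        (ℕP.+-identityʳ _)
∑-tabulate-point u g (fsuc j₀) vanish =
  trans (cong (_+ ∑ u (tabulate (g ∘ fsuc))) (vanish fzero (λ ())))
        (∑-tabulate-point u (g ∘ fsuc) j₀ (λ j j≢j₀ → vanish (fsuc j) (j≢j₀ ∘ FinP.suc-injective)))

sum-cartesianProductWith : {A B : Set} (g : A → B → ℕ) (xs : List A) (ys : List B) →
  sum (cartesianProductWith g xs ys) ≡ ∑ (λ x → ∑ (g x) ys) xs
sum-cartesianProductWith g []       ys = refl
sum-cartesianProductWith g (x ∷ xs) ys = begin
  sum (map (g x) ys ++ cartesianProductWith g xs ys)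
    ≡⟨ sum-++ (map (g x) ys) _ ⟩
  sum (map (g x) ys) + sum (cartesianProductWith g xs ys)
    ≡⟨ cong₂ _+_ (sum-map ys) (sum-cartesianProductWith g xs ys) ⟩
  ∑ (g x) ys + ∑ (λ x → ∑ (g x) ys) xs ∎
  where
  open ≡-Reasoning
  sum-map : ∀ zs → sum (map (g x) zs) ≡ ∑ (g x) zs
  sum-map []       = refl
  sum-map (z ∷ zs) = cong (g x z +_) (sum-map zs)

EndpointTest : Set
EndpointTest = ℕ → ℕ → Bool

passing : EndpointTest → Edge → ℕ
passing t (x , y , a , b) = 𝟙 (t x a) + 𝟙 (t y b)

onPeg : ℕ → EndpointTest
onPeg p q _ = q ≡ᵇ p

onPegBelow : ℕ → ℕ → EndpointTest
onPegBelow p h q h′ = (q ≡ᵇ p) ∧ (h′ <ᵇ h)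

count-endpoints : {P : ℕ × ℕ → Set} (P? : Decidable P) (X : Diagram) →
  length (filter P? (endpoints X)) ≡ ∑ (passing (λ q h → does (P? (q , h)))) X
count-endpoints P? X = trans (length-filter P? (endpoints X)) (∑-endpoints X)
  where
  ∑-endpoints : ∀ X → ∑ (λ e → 𝟙 (does (P? e))) (endpoints X) ≡ ∑ (passing (λ q h → does (P? (q , h)))) X
  ∑-endpoints []                  = refl
  ∑-endpoints ((x , y , a , b) ∷ X) =
    trans (cong (𝟙 (does (P? (x , a))) +_) (cong (𝟙 (does (P? (y , b))) +_) (∑-endpoints X)))
          (sym (ℕP.+-assoc (𝟙 (does (P? (x , a)))) _ _))

pegCount-∑ : (p : ℕ) (X : Diagram) → pegCount p X ≡ ∑ (passing (onPeg p)) X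
pegCount-∑ p X = count-endpoints _ X

rank-∑ : (X : Diagram) (p h : ℕ) → rank X p h ≡ ∑ (passing (onPegBelow p h)) X
rank-∑ X p h = count-endpoints _ X

pegCount-++ : (p : ℕ) (X Y : Diagram) → pegCount p (X ++ Y) ≡ pegCount p X + pegCount p Y
pegCount-++ p X Y = begin
  pegCount p (X ++ Y)                                    ≡⟨ pegCount-∑ p (X ++ Y) ⟩
  ∑ (passing (onPeg p)) (X ++ Y)                         ≡⟨ ∑-++ _ X Y ⟩
  ∑ (passing (onPeg p)) X + ∑ (passing (onPeg p)) Y      ≡⟨ sym (cong₂ _+_ (pegCount-∑ p X) (pegCount-∑ p Y)) ⟩
  pegCount p X + pegCount p Y                            ∎
  where open ≡-Reasoning

pegCount-map : (p : ℕ) (g : Edge → Edge) → (∀ e → passing (onPeg p) (g e) ≡ passing (onPeg p) e) →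
               (X : Diagram) → pegCount p (map g X) ≡ pegCount p X
pegCount-map p g keepsPegs X = begin
  pegCount p (map g X)                   ≡⟨ pegCount-∑ p (map g X) ⟩
  ∑ (passing (onPeg p)) (map g X)        ≡⟨ ∑-map _ g X ⟩
  ∑ (passing (onPeg p) ∘ g) X            ≡⟨ ∑-cong X keepsPegs ⟩
  ∑ (passing (onPeg p)) X                ≡⟨ sym (pegCount-∑ p X) ⟩
  pegCount p X                           ∎
  where open ≡-Reasoning

pegCount-rel : (p : ℕ) (X : Diagram) → pegCount p (rel X) ≡ pegCount p X
pegCount-rel p X = pegCount-map p _ (λ { (x , y , a , b) → refl }) X

pegCount-⊕ : (p : ℕ) (X Y : Diagram) → pegCount p (X ⊕ Y) ≡ pegCount p X + pegCount p Y
pegCount-⊕ p X Y = trans (pegCount-++ p X _) (cong (pegCount p X +_) (pegCount-map p _ (λ { (x , y , a , b) → refl }) Y))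

data Trend : Set where
  descent plateau ascent : Trend

trend : {k : ℕ} → Fin k → Fin k → Trend
trend a b with FinP.<-cmp a b
... | tri< _ _ _ = ascent
... | tri≈ _ _ _ = plateau
... | tri> _ _ _ = descent

isDescent isPlateau isAscent : Trend → Bool
isDescent descent = true
isDescent _       = false
isPlateau plateau = true
isPlateau _       = false
isAscent  ascent  = true
isAscent  _       = false

module _ {k : ℕ} (a b : Fin k) where

  descent-bit : does (b FinP.<? a) ≡ isDescent (trend a b)
  descent-bit with FinP.<-cmp a b
  ... | tri< _ _ b≮a = dec-false (b FinP.<? a) b≮a
  ... | tri≈ _ _ b≮a = dec-false (b FinP.<? a) b≮a
  ... | tri> _ _ b<a = dec-true  (b FinP.<? a) b<a

  plateau-bit : does (a FinP.≟ b) ≡ isPlateau (trend a b)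
  plateau-bit with FinP.<-cmp a b
  ... | tri< _ a≢b _ = dec-false (a FinP.≟ b) a≢b
  ... | tri≈ _ a≡b _ = dec-true  (a FinP.≟ b) a≡b
  ... | tri> _ a≢b _ = dec-false (a FinP.≟ b) a≢b

  plateau-bit′ : does (b FinP.≟ a) ≡ isPlateau (trend a b)
  plateau-bit′ with FinP.<-cmp a b
  ... | tri< _ a≢b _ = dec-false (b FinP.≟ a) (a≢b ∘ sym)
  ... | tri≈ _ a≡b _ = dec-true  (b FinP.≟ a) (sym a≡b)
  ... | tri> _ a≢b _ = dec-false (b FinP.≟ a) (a≢b ∘ sym)

  ascent-bit : does (a FinP.<? b) ≡ isAscent (trend a b)
  ascent-bit with FinP.<-cmp a b
  ... | tri< a<b _ _ = dec-true  (a FinP.<? b) a<b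
  ... | tri≈ a≮b _ _ = dec-false (a FinP.<? b) a≮b
  ... | tri> a≮b _ _ = dec-false (a FinP.<? b) a≮b

xHeight yHeight : Sign → ℕ
xHeight plus  = 2
xHeight minus = 1
yHeight plus  = 1
yHeight minus = 2

newSign : Sign → Trend → Sign
newSign _ descent = minus
newSign p plateau = p
newSign _ ascent  = plus

-- The
-- incoming edge has colour a and sits at height y, the outgoing one has colour b and sits
-- at height x; each is lifted by the endpoints of its own colour below it and by all
-- endpoints of smaller colours.
module _ {k : ℕ} where

  x-reconstructed : (p : Sign) (a b : Fin k) →
    suc (when (does (a FinP.≟ b)) (𝟙 (yHeight p <ᵇ xHeight p)) + 𝟙 (does (a FinP.<? b)))
      ≡ xHeight (newSign p (trend a b))
  x-reconstructed p a b rewrite plateau-bit a b | ascent-bit a b with trend a b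
  x-reconstructed p     a b | descent = refl
  x-reconstructed plus  a b | plateau = refl
  x-reconstructed minus a b | plateau = refl
  x-reconstructed p     a b | ascent  = refl

  y-reconstructed : (p : Sign) (a b : Fin k) →
    suc (when (does (b FinP.≟ a)) (𝟙 (xHeight p <ᵇ yHeight p)) + 𝟙 (does (b FinP.<? a)))
      ≡ yHeight (newSign p (trend a b))
  y-reconstructed p a b rewrite plateau-bit′ a b | descent-bit a b with trend a b
  y-reconstructed p     a b | descent = refl
  y-reconstructed plus  a b | plateau = refl
  y-reconstructed minus a b | plateau = refl
  y-reconstructed p     a b | ascent  = refl

nth-lookup : {n : ℕ} (π : Vec Sign n) (i : Fin n) → nth π (toℕ i) ≡ just (lookup π i)
nth-lookup (s ∷ π) fzero    = refl
nth-lookup (s ∷ π) (fsuc i) = nth-lookup π i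

xh-interior : {n : ℕ} (π : Vec Sign n) (i : Fin n) → xh π (suc (suc (toℕ i))) ≡ xHeight (lookup π i)
xh-interior π i = from-nth (nth-lookup π i)
  where
  from-nth : ∀ {m s} → nth π m ≡ just s → xh π (suc (suc m)) ≡ xHeight s
  from-nth {s = plus}  eq rewrite eq = refl
  from-nth {s = minus} eq rewrite eq = refl

yh-interior : {n : ℕ} (π : Vec Sign n) (i : Fin n) → yh π (suc (suc (toℕ i))) ≡ yHeight (lookup π i)
yh-interior π i = from-nth (nth-lookup π i)
  where
  from-nth : ∀ {m s} → nth π m ≡ just s → yh π (suc (suc m)) ≡ yHeight s
  from-nth {s = plus}  eq rewrite eq = refl
  from-nth {s = minus} eq rewrite eq = refl

nth-beyond : {n : ℕ} (π : Vec Sign n) → nth π n ≡ nothing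
nth-beyond []      = refl
nth-beyond (_ ∷ π) = nth-beyond π

yh-last : {n : ℕ} (π : Vec Sign n) → yh π (suc (suc n)) ≡ 1
yh-last π rewrite nth-beyond π = refl

xHeight-injective : ∀ {s s′} → xHeight s ≡ xHeight s′ → s ≡ s′
xHeight-injective {plus}  {plus}  _ = refl
xHeight-injective {minus} {minus} _ = refl

edge-determines-sign : ∀ {n} (σ τ : Vec Sign n) i j → edge σ (fsuc i) ≡ edge τ j → lookup σ i ≡ lookup τ i
edge-determines-sign σ τ i j same with FinP.toℕ-injective {i = fsuc i} {j = j} (ℕP.suc-injective (cong proj₁ same))
... | refl = xHeight-injective (trans (sym (xh-interior σ i))
                                      (trans (cong (proj₁ ∘ proj₂ ∘ proj₂) same) (xh-interior τ i)))

module Reconstruction {n k : ℕ} (π : Vec Sign n) (c : Vec (Fin k) (suc n)) where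

  selected : {P : Fin (suc n) → Set} → Decidable P → Diagram
  selected P? = map (edge π) (filter P? (allFin (suc n)))

  ∑-selected : {P : Fin (suc n) → Set} (P? : Decidable P) (w : Edge → ℕ) →
               ∑ w (selected P?) ≡ ∑ (λ j → when (does (P? j)) (w (edge π j))) (allFin (suc n))
  ∑-selected P? w = trans (∑-map w (edge π) (filter P? (allFin (suc n)))) (∑-filter P? (w ∘ edge π) (allFin (suc n)))

  pegCount-selected : {P : Fin (suc n) → Set} (P? : Decidable P) (p : ℕ) →
    pegCount p (selected P?) ≡ ∑ (λ j → when (does (P? j)) (passing (onPeg p) (edge π j))) (allFin (suc n))
  pegCount-selected P? p = trans (pegCount-∑ p (selected P?)) (∑-selected P? (passing (onPeg p)))

  lower : ℕ → Diagram
  lower d = selected (λ j → toℕ (lookup c j) ℕ.<? d)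

  -- How far the endpoint of edge j at (p , h) is lifted: rel ranks it among the endpoints
  -- of its own colour class, ⊕ stacks it on all endpoints of smaller colours.
  lift : Fin (suc n) → ℕ → ℕ → ℕ
  lift j p h = rank (colourClass π c (lookup c j)) p h + pegCount p (lower (toℕ (lookup c j)))

  raised : Fin k → Fin (suc n) → ℕ → ℕ → Edge
  raised t j u v = (suc (toℕ j) , suc (suc (toℕ j)) ,
    suc (rank (colourClass π c t) (suc (toℕ j)) (xh π (suc (toℕ j)))) + u ,
    suc (rank (colourClass π c t) (suc (suc (toℕ j))) (yh π (suc (suc (toℕ j))))) + v)

  placed : Fin k → Diagram → Fin (suc n) → Edge
  placed t acc j = raised t j (pegCount (suc (toℕ j)) acc) (pegCount (suc (suc (toℕ j))) acc)

  -- Edge j as it appears in R(D_π , c): placed on top of all edges of smaller colour.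
  -- Its new heights are suc (lift j p h) at its two endpoints (p , h).
  lifted : Fin (suc n) → Edge
  lifted j = placed (lookup c j) (lower (toℕ (lookup c j))) j

  step : Diagram → Fin k → Diagram
  step acc t = acc ⊕ rel (colourClass π c t)

  record Processed (d : ℕ) (acc : Diagram) : Set where
    field
      pegs     : ∀ p → pegCount p acc ≡ pegCount p (lower d)
      sound    : ∀ {e} → e ∈ acc → ∃[ j ] (toℕ (lookup c j) ℕ.< d × e ≡ lifted j)
      complete : ∀ j → toℕ (lookup c j) ℕ.< d → lifted j ∈ acc
  open Processed

  lower-step : ∀ p t → pegCount p (lower (toℕ t)) + pegCount p (colourClass π c t) ≡ pegCount p (lower (suc (toℕ t)))
  lower-step p t = begin
    pegCount p (lower (toℕ t)) + pegCount p (colourClass π c t)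
      ≡⟨ cong₂ _+_ (pegCount-selected (λ j → toℕ (lookup c j) ℕ.<? toℕ t) p)
                   (pegCount-selected (λ j → lookup c j FinP.≟ t) p) ⟩
    ∑ (λ j → when (below j) (w j)) all + ∑ (λ j → when (equal j) (w j)) all
      ≡⟨ sym (∑-+ (λ j → when (below j) (w j)) (λ j → when (equal j) (w j)) all) ⟩
    ∑ (λ j → when (below j) (w j) + when (equal j) (w j)) all
      ≡⟨ ∑-cong all (λ j → split (lookup c j) (w j)) ⟩
    ∑ (λ j → when (does (toℕ (lookup c j) ℕ.<? suc (toℕ t))) (w j)) all
      ≡⟨ sym (pegCount-selected (λ j → toℕ (lookup c j) ℕ.<? suc (toℕ t)) p) ⟩
    pegCount p (lower (suc (toℕ t))) ∎
    where
    open ≡-Reasoning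
    all : List (Fin (suc n))
    all = allFin (suc n)
    w : Fin (suc n) → ℕ
    w j = passing (onPeg p) (edge π j)
    below equal : Fin (suc n) → Bool
    below j = does (toℕ (lookup c j) ℕ.<? toℕ t)
    equal j = does (lookup c j FinP.≟ t)
    split : ∀ a v → when (does (toℕ a ℕ.<? toℕ t)) v + when (does (a FinP.≟ t)) v ≡ when (does (toℕ a ℕ.<? suc (toℕ t))) v
    split a v with FinP.<-cmp a t
    ... | tri< a<t a≢t _ rewrite dec-true (toℕ a ℕ.<? toℕ t) a<t | dec-false (a FinP.≟ t) a≢t
                               | dec-true (toℕ a ℕ.<? suc (toℕ t)) (ℕP.m<n⇒m<1+n a<t) = ℕP.+-identityʳ v
    ... | tri≈ a≮t a≡t _ rewrite dec-false (toℕ a ℕ.<? toℕ t) a≮t | dec-true (a FinP.≟ t) a≡t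
                               | dec-true (toℕ a ℕ.<? suc (toℕ t)) (ℕP.≤-reflexive (cong suc (cong toℕ a≡t))) = refl
    ... | tri> a≮t a≢t t<a rewrite dec-false (toℕ a ℕ.<? toℕ t) a≮t | dec-false (a FinP.≟ t) a≢t
                               | dec-false (toℕ a ℕ.<? suc (toℕ t)) (λ a<1+t → ℕP.<-irrefl refl (ℕP.<-≤-trans t<a (ℕP.≤-pred a<1+t))) = refl

  placed-pegs : ∀ t acc acc′ j → (∀ p → pegCount p acc ≡ pegCount p acc′) → placed t acc j ≡ placed t acc′ j
  placed-pegs t acc acc′ j same = cong₂ (raised t j) (same _) (same _)

  step-inversion : ∀ t acc {e} → e ∈ step acc t → e ∈ acc ⊎ ∃[ j ] (lookup c j ≡ t × e ≡ placed t acc j)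
  step-inversion t acc e∈ with ∈-++⁻ acc e∈
  ... | inj₁ e∈acc = inj₁ e∈acc
  ... | inj₂ e∈new with ∈-map⁻ _ e∈new
  ... | _ , e∈rel , refl with ∈-map⁻ _ e∈rel
  ... | _ , e∈class , refl with ∈-map⁻ (edge π) e∈class
  ... | j , j∈filter , refl = inj₂ (j , proj₂ (∈-filter⁻ (λ i → lookup c i FinP.≟ t) {xs = allFin (suc n)} j∈filter) , refl)

  placed∈step : ∀ t acc j → lookup c j ≡ t → placed t acc j ∈ step acc t
  placed∈step t acc j colour≡t =
    ∈-++⁺ʳ acc (∈-map⁺ _ (∈-map⁺ _ (∈-map⁺ (edge π) (∈-filter⁺ (λ i → lookup c i FinP.≟ t) (∈-allFin j) colour≡t))))

  step-processed : ∀ t acc → Processed (toℕ t) acc → Processed (suc (toℕ t)) (step acc t)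
  pegs (step-processed t acc I) p = begin
    pegCount p (step acc t)                                        ≡⟨ pegCount-⊕ p acc (rel (colourClass π c t)) ⟩
    pegCount p acc + pegCount p (rel (colourClass π c t))          ≡⟨ cong₂ _+_ (pegs I p) (pegCount-rel p (colourClass π c t)) ⟩
    pegCount p (lower (toℕ t)) + pegCount p (colourClass π c t)    ≡⟨ lower-step p t ⟩
    pegCount p (lower (suc (toℕ t)))                               ∎
    where open ≡-Reasoning
  sound (step-processed t acc I) e∈ with step-inversion t acc e∈
  ... | inj₁ e∈acc with sound I e∈acc
  ...   | j , below , e≡ = j , ℕP.m<n⇒m<1+n below , e≡
  sound (step-processed t acc I) e∈ | inj₂ (j , refl , e≡) =
    j , ℕP.n<1+n _ , trans e≡ (placed-pegs (lookup c j) acc (lower (toℕ (lookup c j))) j (pegs I))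
  complete (step-processed t acc I) j below with ℕP.m<1+n⇒m<n∨m≡n below
  ... | inj₁ below′  = ∈-++⁺ˡ (complete I j below′)
  ... | inj₂ colour≡ with FinP.toℕ-injective colour≡
  ...   | refl = subst (_∈ step acc (lookup c j)) (placed-pegs (lookup c j) acc (lower (toℕ (lookup c j))) j (pegs I)) (placed∈step (lookup c j) acc j refl)

  nothing-processed : Processed 0 []
  pegs     nothing-processed p = sym (trans (pegCount-selected (λ j → toℕ (lookup c j) ℕ.<? 0) p)
                                            (∑-zero (allFin (suc n)) (λ _ _ → refl)))
  sound    nothing-processed ()
  complete nothing-processed j ()

  fold-processed : ∀ m (g : Fin m → Fin k) d acc → (∀ i → toℕ (g i) ≡ d + toℕ i) →
                   Processed d acc → Processed (d + m) (foldl step acc (tabulate g))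
  fold-processed zero    g d acc consecutive I = subst (λ d′ → Processed d′ acc) (sym (ℕP.+-identityʳ d)) I
  fold-processed (suc m) g d acc consecutive I =
    subst (λ d′ → Processed d′ (foldl step (step acc (g fzero)) (tabulate (g ∘ fsuc)))) (sym (ℕP.+-suc d m))
      (fold-processed m (g ∘ fsuc) (suc d) (step acc (g fzero))
        (λ i → trans (consecutive (fsuc i)) (ℕP.+-suc d (toℕ i))) next)
    where
    first : toℕ (g fzero) ≡ d
    first = trans (consecutive fzero) (ℕP.+-identityʳ d)
    next : Processed (suc d) (step acc (g fzero))
    next = subst (λ d′ → Processed (suc d′) (step acc (g fzero))) first
             (step-processed (g fzero) acc (subst (λ d′ → Processed d′ acc) (sym first) I))

  R-processed : Processed k (R π c)
  R-processed = fold-processed k id 0 [] (λ _ → refl) nothing-processed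

  R-sound : ∀ {e} → e ∈ R π c → ∃[ j ] e ≡ lifted j
  R-sound e∈ with sound R-processed e∈
  ... | j , _ , e≡ = j , e≡

  R-complete : ∀ j → lifted j ∈ R π c
  R-complete j = complete R-processed j (FinP.toℕ<n (lookup c j))

  contribution : Fin (suc n) → ℕ → ℕ → Fin (suc n) → ℕ
  contribution j p h j′ =
    when (does (lookup c j′ FinP.≟ lookup c j)) (passing (onPegBelow p h) (edge π j′)) +
    when (does (lookup c j′ FinP.<? lookup c j)) (passing (onPeg p) (edge π j′))

  lift-∑ : ∀ j p h → lift j p h ≡ ∑ (contribution j p h) (allFin (suc n))
  lift-∑ j p h = begin
    rank (colourClass π c (lookup c j)) p h + pegCount p (lower (toℕ (lookup c j)))
      ≡⟨ cong₂ _+_ (trans (rank-∑ (colourClass π c (lookup c j)) p h)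
                          (∑-selected (λ j′ → lookup c j′ FinP.≟ lookup c j) (passing (onPegBelow p h))))
                   (pegCount-selected (λ j′ → toℕ (lookup c j′) ℕ.<? toℕ (lookup c j)) p) ⟩
    ∑ sameColour (allFin (suc n)) + ∑ smallerColour (allFin (suc n))
      ≡⟨ sym (∑-+ sameColour smallerColour (allFin (suc n))) ⟩
    ∑ (contribution j p h) (allFin (suc n)) ∎
    where
    open ≡-Reasoning
    sameColour smallerColour : Fin (suc n) → ℕ
    sameColour    j′ = when (does (lookup c j′ FinP.≟ lookup c j)) (passing (onPegBelow p h) (edge π j′))
    smallerColour j′ = when (does (lookup c j′ FinP.<? lookup c j)) (passing (onPeg p) (edge π j′))

  contribution-off : ∀ j j′ p h → toℕ j′ ≢ p → suc (toℕ j′) ≢ p → contribution j (suc p) h j′ ≡ 0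
  contribution-off j j′ p h left≢ right≢ rewrite ≢⇒≡ᵇ-false left≢ | ≢⇒≡ᵇ-false right≢ =
    cong₂ _+_ (when-zero (does (lookup c j′ FinP.≟ lookup c j))) (when-zero (does (lookup c j′ FinP.<? lookup c j)))

  contribution-self-left : ∀ j → contribution j (suc (toℕ j)) (xh π (suc (toℕ j))) j ≡ 0
  contribution-self-left j
    rewrite ≡ᵇ-refl (toℕ j) | <ᵇ-irrefl (xh π (suc (toℕ j))) | ≢⇒≡ᵇ-false (ℕP.1+n≢n {toℕ j})
          | dec-false (lookup c j FinP.<? lookup c j) (FinP.<-irrefl refl) = cong (_+ 0) (when-zero (does (lookup c j FinP.≟ lookup c j)))

  contribution-self-right : ∀ j → contribution j (suc (suc (toℕ j))) (yh π (suc (suc (toℕ j)))) j ≡ 0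
  contribution-self-right j
    rewrite ≡ᵇ-refl (toℕ j) | <ᵇ-irrefl (yh π (suc (suc (toℕ j)))) | ≢⇒≡ᵇ-false (ℕP.1+n≢n {toℕ j} ∘ sym)
          | dec-false (lookup c j FinP.<? lookup c j) (FinP.<-irrefl refl) = cong (_+ 0) (when-zero (does (lookup c j FinP.≟ lookup c j)))

  -- On the interior peg i + 2, the incoming edge i lifts the outgoing edge i + 1 and
  -- conversely; these are the only contributions there.
  contribution-incoming : ∀ i →
    contribution (fsuc i) (suc (suc (toℕ i))) (xh π (suc (suc (toℕ i)))) (inject₁ i)
      ≡ when (does (lookup c (inject₁ i) FinP.≟ lookup c (fsuc i))) (𝟙 (yh π (suc (suc (toℕ i))) <ᵇ xh π (suc (suc (toℕ i)))))
        + 𝟙 (does (lookup c (inject₁ i) FinP.<? lookup c (fsuc i)))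
  contribution-incoming i
    rewrite FinP.toℕ-inject₁ i | ≢⇒≡ᵇ-false (ℕP.1+n≢n {toℕ i} ∘ sym) | ≡ᵇ-refl (toℕ i) = refl

  contribution-outgoing : ∀ i →
    contribution (inject₁ i) (suc (suc (toℕ (inject₁ i)))) (yh π (suc (suc (toℕ (inject₁ i))))) (fsuc i)
      ≡ when (does (lookup c (fsuc i) FinP.≟ lookup c (inject₁ i))) (𝟙 (xh π (suc (suc (toℕ i))) <ᵇ yh π (suc (suc (toℕ i)))))
        + 𝟙 (does (lookup c (fsuc i) FinP.<? lookup c (inject₁ i)))
  contribution-outgoing i
    rewrite FinP.toℕ-inject₁ i | ≢⇒≡ᵇ-false (ℕP.1+n≢n {toℕ i}) | ≡ᵇ-refl (toℕ i) =
    cong (_+ _) (cong (when (does (lookup c (fsuc i) FinP.≟ lookup c (inject₁ i)))) (ℕP.+-identityʳ _))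

  lift-first : lift fzero 1 1 ≡ 0
  lift-first = trans (lift-∑ fzero 1 1) (∑-zero (allFin (suc n)) vanish)
    where
    vanish : ∀ j′ → j′ ∈ allFin (suc n) → contribution fzero 1 1 j′ ≡ 0
    vanish fzero      _ = contribution-self-left fzero
    vanish (fsuc j′) _ = contribution-off fzero (fsuc j′) 0 1 (λ ()) (λ ())

  lift-last : lift (fromℕ n) (suc (suc (toℕ (fromℕ n)))) (yh π (suc (suc (toℕ (fromℕ n))))) ≡ 0
  lift-last = trans (lift-∑ (fromℕ n) peg height) (∑-zero (allFin (suc n)) vanish)
    where
    peg height : ℕ
    peg    = suc (suc (toℕ (fromℕ n)))
    height = yh π peg
    vanish : ∀ j′ → j′ ∈ allFin (suc n) → contribution (fromℕ n) peg height j′ ≡ 0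
    vanish j′ _ with toℕ j′ ℕP.≟ toℕ (fromℕ n)
    ... | yes j′≡ = subst (λ j′ → contribution (fromℕ n) peg height j′ ≡ 0) (sym (FinP.toℕ-injective j′≡))
                          (contribution-self-right (fromℕ n))
    ... | no  j′≢ = contribution-off (fromℕ n) j′ (suc (toℕ (fromℕ n))) height
                      (λ j′≡ → ℕP.<-irrefl (trans j′≡ (cong suc (FinP.toℕ-fromℕ n))) (FinP.toℕ<n j′))
                      (j′≢ ∘ ℕP.suc-injective)

  lift-interior-x : ∀ i →
    lift (fsuc i) (suc (suc (toℕ i))) (xh π (suc (suc (toℕ i))))
      ≡ when (does (lookup c (inject₁ i) FinP.≟ lookup c (fsuc i))) (𝟙 (yh π (suc (suc (toℕ i))) <ᵇ xh π (suc (suc (toℕ i)))))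
        + 𝟙 (does (lookup c (inject₁ i) FinP.<? lookup c (fsuc i)))
  lift-interior-x i = trans (lift-∑ (fsuc i) peg height)
    (trans (∑-tabulate-point (contribution (fsuc i) peg height) id (inject₁ i) vanish) (contribution-incoming i))
    where
    peg height : ℕ
    peg    = suc (suc (toℕ i))
    height = xh π peg
    vanish : ∀ j′ → j′ ≢ inject₁ i → contribution (fsuc i) peg height j′ ≡ 0
    vanish j′ j′≢ with toℕ j′ ℕP.≟ suc (toℕ i)
    ... | yes j′≡ = subst (λ j′ → contribution (fsuc i) peg height j′ ≡ 0) (sym (FinP.toℕ-injective j′≡))
                          (contribution-self-left (fsuc i))
    ... | no  j′≢′ = contribution-off (fsuc i) j′ (suc (toℕ i)) height j′≢′
                       (λ j′≡ → j′≢ (FinP.toℕ-injective (trans (ℕP.suc-injective j′≡) (sym (FinP.toℕ-inject₁ i)))))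

  lift-interior-y : ∀ i →
    lift (inject₁ i) (suc (suc (toℕ (inject₁ i)))) (yh π (suc (suc (toℕ (inject₁ i)))))
      ≡ when (does (lookup c (fsuc i) FinP.≟ lookup c (inject₁ i))) (𝟙 (xh π (suc (suc (toℕ i))) <ᵇ yh π (suc (suc (toℕ i)))))
        + 𝟙 (does (lookup c (fsuc i) FinP.<? lookup c (inject₁ i)))
  lift-interior-y i = trans (lift-∑ (inject₁ i) peg height)
    (trans (∑-tabulate-point (contribution (inject₁ i) peg height) id (fsuc i) vanish) (contribution-outgoing i))
    where
    peg height : ℕ
    peg    = suc (suc (toℕ (inject₁ i)))
    height = yh π peg
    vanish : ∀ j′ → j′ ≢ fsuc i → contribution (inject₁ i) peg height j′ ≡ 0
    vanish j′ j′≢ with toℕ j′ ℕP.≟ toℕ (inject₁ i)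
    ... | yes j′≡ = subst (λ j′ → contribution (inject₁ i) peg height j′ ≡ 0) (sym (FinP.toℕ-injective j′≡))
                          (contribution-self-right (inject₁ i))
    ... | no  j′≢′ = contribution-off (inject₁ i) j′ (suc (toℕ (inject₁ i))) height
                       (λ j′≡ → j′≢ (FinP.toℕ-injective (trans j′≡ (cong suc (FinP.toℕ-inject₁ i)))))
                       (j′≢′ ∘ ℕP.suc-injective)

  signs : Vec Sign n
  signs = Vec.tabulate (λ i → newSign (lookup π i) (trend (lookup c (inject₁ i)) (lookup c (fsuc i))))

  lifted-x : ∀ j → suc (lift j (suc (toℕ j)) (xh π (suc (toℕ j)))) ≡ xh signs (suc (toℕ j))
  lifted-x fzero    = cong suc lift-first
  lifted-x (fsuc i) = begin
    suc (lift (fsuc i) _ _)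
      ≡⟨ cong suc (lift-interior-x i) ⟩
    suc (when (does (a FinP.≟ b)) (𝟙 (yh π peg <ᵇ xh π peg)) + 𝟙 (does (a FinP.<? b)))
      ≡⟨ cong₂ (λ y x → suc (when (does (a FinP.≟ b)) (𝟙 (y <ᵇ x)) + 𝟙 (does (a FinP.<? b))))
               (yh-interior π i) (xh-interior π i) ⟩
    suc (when (does (a FinP.≟ b)) (𝟙 (yHeight (lookup π i) <ᵇ xHeight (lookup π i))) + 𝟙 (does (a FinP.<? b)))
      ≡⟨ x-reconstructed (lookup π i) a b ⟩
    xHeight (newSign (lookup π i) (trend a b))
      ≡⟨ cong xHeight (sym (VecP.lookup∘tabulate _ i)) ⟩
    xHeight (lookup signs i)
      ≡⟨ sym (xh-interior signs i) ⟩
    xh signs (suc (suc (toℕ i))) ∎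
    where
    open ≡-Reasoning
    peg : ℕ
    peg = suc (suc (toℕ i))
    a b : Fin k
    a = lookup c (inject₁ i)
    b = lookup c (fsuc i)

  lifted-y : ∀ j → View j → suc (lift j (suc (suc (toℕ j))) (yh π (suc (suc (toℕ j))))) ≡ yh signs (suc (suc (toℕ j)))
  lifted-y _ ‵fromℕ = begin
    suc (lift (fromℕ n) _ _)                 ≡⟨ cong suc lift-last ⟩
    1                                        ≡⟨ sym (yh-last signs) ⟩
    yh signs (suc (suc n))                   ≡⟨ cong (λ m → yh signs (suc (suc m))) (sym (FinP.toℕ-fromℕ n)) ⟩
    yh signs (suc (suc (toℕ (fromℕ n))))     ∎
    where open ≡-Reasoning
  lifted-y _ (‵inject₁ i) = begin
    suc (lift (inject₁ i) _ _)
      ≡⟨ cong suc (lift-interior-y i) ⟩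
    suc (when (does (b FinP.≟ a)) (𝟙 (xh π peg <ᵇ yh π peg)) + 𝟙 (does (b FinP.<? a)))
      ≡⟨ cong₂ (λ x y → suc (when (does (b FinP.≟ a)) (𝟙 (x <ᵇ y)) + 𝟙 (does (b FinP.<? a))))
               (xh-interior π i) (yh-interior π i) ⟩
    suc (when (does (b FinP.≟ a)) (𝟙 (xHeight (lookup π i) <ᵇ yHeight (lookup π i))) + 𝟙 (does (b FinP.<? a)))
      ≡⟨ y-reconstructed (lookup π i) a b ⟩
    yHeight (newSign (lookup π i) (trend a b))
      ≡⟨ cong yHeight (sym (VecP.lookup∘tabulate _ i)) ⟩
    yHeight (lookup signs i)
      ≡⟨ sym (yh-interior signs i) ⟩
    yh signs (suc (suc (toℕ i)))
      ≡⟨ cong (λ m → yh signs (suc (suc m))) (sym (FinP.toℕ-inject₁ i)) ⟩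
    yh signs (suc (suc (toℕ (inject₁ i)))) ∎
    where
    open ≡-Reasoning
    peg : ℕ
    peg = suc (suc (toℕ i))
    a b : Fin k
    a = lookup c (inject₁ i)
    b = lookup c (fsuc i)

  lifted-edge : ∀ j → lifted j ≡ edge signs j
  lifted-edge j = cong₂ (λ u v → (suc (toℕ j) , suc (suc (toℕ j)) , u , v)) (lifted-x j) (lifted-y j (view j))

  reconstruction : (σ : Vec Sign n) → SameSet (R π c) (D σ) ⇔ signs ≡ σ
  reconstruction σ = mk⇔ to from
    where
    to : SameSet (R π c) (D σ) → signs ≡ σ
    to (R⊆Dσ , _) = Pointwise-≡⇒≡ (ext agree)
      where
      agree : ∀ i → lookup signs i ≡ lookup σ i
      agree i with ∈-map⁻ (edge σ) (All.lookup R⊆Dσ (R-complete (fsuc i)))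
      ... | j , _ , lifted≡ = edge-determines-sign signs σ i j (trans (sym (lifted-edge (fsuc i))) lifted≡)
    from : signs ≡ σ → SameSet (R π c) (D σ)
    from refl = All.tabulate R⊆D , All.tabulate D⊆R
      where
      R⊆D : ∀ {e} → e ∈ R π c → e ∈ D signs
      R⊆D e∈ = let (j , e≡) = R-sound e∈ in
               subst (_∈ D signs) (sym (trans e≡ (lifted-edge j))) (∈-map⁺ (edge signs) (∈-allFin j))
      D⊆R : ∀ {e} → e ∈ D signs → e ∈ R π c
      D⊆R e∈ = let (j , _ , e≡) = ∈-map⁻ (edge signs) e∈ in
               subst (_∈ R π c) (trans (lifted-edge j) (sym e≡)) (R-complete j)

-- The class of a peg with signs (p , s) in π and σ admits exactly the trends t with
-- newSign p t ≡ s: Y₁ only descents, Y₂ descents and plateaux, Y₃ plateaux and ascents,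
-- Y₄ only ascents.  A decomposition of the Des/Equ/Asc-pattern of a colouring as in the
-- theorem then assigns Y₂-descents to A and Y₃-ascents to B.  Both directions are checked
-- peg by peg, with x and y the memberships of the peg in A and B.
decomposition-at-sound : ∀ p s t x y → x Bool.≤ Y₂f p s → y Bool.≤ Y₃f p s →
  isDescent t ≡ Y₁f p s ∨ x → isAscent t ≡ Y₄f p s ∨ y → isPlateau t ≡ (Y₂f p s ∨ Y₃f p s) ∧ not (x ∨ y) →
  newSign p t ≡ s × x ≡ Y₂f p s ∧ isDescent t × y ≡ Y₃f p s ∧ isAscent t
decomposition-at-sound plus  minus descent x y b≤b b≤b refl refl refl = refl , refl , refl
decomposition-at-sound plus  minus plateau x y _   _   ()   _    _
decomposition-at-sound plus  minus ascent  x y _   _   ()   _    _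
decomposition-at-sound minus minus descent x y _   b≤b refl refl refl = refl , refl , refl
decomposition-at-sound minus minus plateau x y _   b≤b refl refl refl = refl , refl , refl
decomposition-at-sound minus minus ascent  x y _   b≤b refl ()   _
decomposition-at-sound plus  plus  descent x y b≤b _   ()   _    _
decomposition-at-sound plus  plus  plateau x y b≤b _   refl refl refl = refl , refl , refl
decomposition-at-sound plus  plus  ascent  x y b≤b _   refl refl refl = refl , refl , refl
decomposition-at-sound minus plus  descent x y b≤b b≤b ()   _    _
decomposition-at-sound minus plus  plateau x y b≤b b≤b refl ()   _
decomposition-at-sound minus plus  ascent  x y b≤b b≤b refl refl refl = refl , refl , refl

decomposition-at-complete : ∀ p s t → newSign p t ≡ s →
  let x = Y₂f p s ∧ isDescent t ; y = Y₃f p s ∧ isAscent t in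
  isDescent t ≡ Y₁f p s ∨ x × isAscent t ≡ Y₄f p s ∨ y × isPlateau t ≡ (Y₂f p s ∨ Y₃f p s) ∧ not (x ∨ y)
decomposition-at-complete plus  _ descent refl = refl , refl , refl
decomposition-at-complete minus _ descent refl = refl , refl , refl
decomposition-at-complete plus  _ plateau refl = refl , refl , refl
decomposition-at-complete minus _ plateau refl = refl , refl , refl
decomposition-at-complete plus  _ ascent  refl = refl , refl , refl
decomposition-at-complete minus _ ascent  refl = refl , refl , refl

∪-lookup : {m : ℕ} (X Y : Subset m) (i : Fin m) → lookup (X ∪ Y) i ≡ lookup X i ∨ lookup Y i
∪-lookup X Y i = VecP.lookup-zipWith _∨_ i X Y

─-lookup : {m : ℕ} (X Y : Subset m) (i : Fin m) → lookup (X ─ Y) i ≡ lookup X i ∧ not (lookup Y i)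
─-lookup (x ∷ X) (true  ∷ Y) fzero    = sym (BoolP.∧-zeroʳ x)
─-lookup (x ∷ X) (false ∷ Y) fzero    = sym (BoolP.∧-identityʳ x)
─-lookup (_ ∷ X) (_ ∷ Y)     (fsuc i) = ─-lookup X Y i

⊆⇒≤ : {m : ℕ} {X Y : Subset m} → X ⊆ Y → ∀ i → lookup X i Bool.≤ lookup Y i
⊆⇒≤ {X = X} {Y} X⊆Y i with lookup X i in X[i] | lookup Y i in Y[i]
... | false | false = b≤b
... | false | true  = f≤t
... | true  | true  = b≤b
... | true  | false with trans (sym ([]=⇒lookup (X⊆Y (lookup⇒[]= i X X[i])))) Y[i]
...   | ()

≤⇒⊆ : {m : ℕ} {X Y : Subset m} → (∀ i → lookup X i Bool.≤ lookup Y i) → X ⊆ Y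
≤⇒⊆ {Y = Y} X≤Y {i} i∈X = lookup⇒[]= i Y (inside-≤ (X≤Y i) ([]=⇒lookup i∈X))
  where
  inside-≤ : ∀ {a b} → a Bool.≤ b → a ≡ true → b ≡ true
  inside-≤ b≤b a≡true = a≡true

∧-≤ˡ : ∀ a b → a ∧ b Bool.≤ a
∧-≤ˡ true  true  = b≤b
∧-≤ˡ true  false = f≤t
∧-≤ˡ false _     = b≤b

module Decomposition {n k : ℕ} (π σ : Vec Sign n) (c : Vec (Fin k) (suc n)) where
  open Reconstruction π c using (signs; reconstruction)

  IsDecomposition : Subset n → Subset n → Set
  IsDecomposition A B = InWordEuler (Y₁ π σ ∪ A) ((Y₂ π σ ∪ Y₃ π σ) ─ (A ∪ B)) (Y₄ π σ ∪ B) c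

  π[_] σ[_] : Fin n → Sign
  π[ i ] = lookup π i
  σ[ i ] = lookup σ i

  -- The trend of c across the interior peg i + 2.
  trendAt : Fin n → Trend
  trendAt i = trend (lookup c (inject₁ i)) (lookup c (fsuc i))

  signs-at : ∀ i → lookup signs i ≡ newSign π[ i ] (trendAt i)
  signs-at i = VecP.lookup∘tabulate _ i

  forcedA forcedB : Subset n
  forcedA = Vec.tabulate (λ i → Y₂f π[ i ] σ[ i ] ∧ isDescent (trendAt i))
  forcedB = Vec.tabulate (λ i → Y₃f π[ i ] σ[ i ] ∧ isAscent (trendAt i))

  Y-at : (f : Sign → Sign → Bool) (i : Fin n) → lookup (Vec.tabulate (λ j → f π[ j ] σ[ j ])) i ≡ f π[ i ] σ[ i ]
  Y-at f i = VecP.lookup∘tabulate _ i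

  Des-at : ∀ i → lookup (Des c) i ≡ isDescent (trendAt i)
  Des-at i = trans (VecP.lookup∘tabulate _ i) (descent-bit (lookup c (inject₁ i)) (lookup c (fsuc i)))

  Equ-at : ∀ i → lookup (Equ c) i ≡ isPlateau (trendAt i)
  Equ-at i = trans (VecP.lookup∘tabulate _ i) (plateau-bit (lookup c (inject₁ i)) (lookup c (fsuc i)))

  Asc-at : ∀ i → lookup (Asc c) i ≡ isAscent (trendAt i)
  Asc-at i = trans (VecP.lookup∘tabulate _ i) (ascent-bit (lookup c (inject₁ i)) (lookup c (fsuc i)))

  first-at : ∀ A i → lookup (Y₁ π σ ∪ A) i ≡ Y₁f π[ i ] σ[ i ] ∨ lookup A i
  first-at A i = trans (∪-lookup (Y₁ π σ) A i) (cong (_∨ lookup A i) (Y-at Y₁f i))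

  middle-at : ∀ A B i → lookup ((Y₂ π σ ∪ Y₃ π σ) ─ (A ∪ B)) i
                        ≡ (Y₂f π[ i ] σ[ i ] ∨ Y₃f π[ i ] σ[ i ]) ∧ not (lookup A i ∨ lookup B i)
  middle-at A B i = begin
    lookup ((Y₂ π σ ∪ Y₃ π σ) ─ (A ∪ B)) i
      ≡⟨ ─-lookup (Y₂ π σ ∪ Y₃ π σ) (A ∪ B) i ⟩
    lookup (Y₂ π σ ∪ Y₃ π σ) i ∧ not (lookup (A ∪ B) i)
      ≡⟨ cong₂ (λ u v → u ∧ not v) (∪-lookup (Y₂ π σ) (Y₃ π σ) i) (∪-lookup A B i) ⟩
    (lookup (Y₂ π σ) i ∨ lookup (Y₃ π σ) i) ∧ not (lookup A i ∨ lookup B i)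
      ≡⟨ cong₂ (λ u v → (u ∨ v) ∧ not (lookup A i ∨ lookup B i)) (Y-at Y₂f i) (Y-at Y₃f i) ⟩
    (Y₂f π[ i ] σ[ i ] ∨ Y₃f π[ i ] σ[ i ]) ∧ not (lookup A i ∨ lookup B i) ∎
    where open ≡-Reasoning

  last-at : ∀ B i → lookup (Y₄ π σ ∪ B) i ≡ Y₄f π[ i ] σ[ i ] ∨ lookup B i
  last-at B i = trans (∪-lookup (Y₄ π σ) B i) (cong (_∨ lookup B i) (Y-at Y₄f i))

  decomposition-sound : ∀ {A B} → A ⊆ Y₂ π σ → B ⊆ Y₃ π σ → IsDecomposition A B →
                        signs ≡ σ × A ≡ forcedA × B ≡ forcedB
  decomposition-sound {A} {B} A⊆Y₂ B⊆Y₃ (_ , Des≡ , Equ≡ , Asc≡) =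
    Pointwise-≡⇒≡ (ext (λ i → trans (signs-at i) (proj₁ (at i)))) ,
    Pointwise-≡⇒≡ (ext (λ i → trans (proj₁ (proj₂ (at i))) (sym (VecP.lookup∘tabulate _ i)))) ,
    Pointwise-≡⇒≡ (ext (λ i → trans (proj₂ (proj₂ (at i))) (sym (VecP.lookup∘tabulate _ i))))
    where
    read : ∀ {X Y : Subset n} i → X ≡ Y → lookup X i ≡ lookup Y i
    read i X≡Y = cong (λ X → lookup X i) X≡Y
    at : ∀ i → newSign π[ i ] (trendAt i) ≡ σ[ i ] ×
               lookup A i ≡ Y₂f π[ i ] σ[ i ] ∧ isDescent (trendAt i) ×
               lookup B i ≡ Y₃f π[ i ] σ[ i ] ∧ isAscent (trendAt i)
    at i = decomposition-at-sound π[ i ] σ[ i ] (trendAt i) (lookup A i) (lookup B i)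
             (subst (lookup A i Bool.≤_) (Y-at Y₂f i) (⊆⇒≤ A⊆Y₂ i))
             (subst (lookup B i Bool.≤_) (Y-at Y₃f i) (⊆⇒≤ B⊆Y₃ i))
             (trans (sym (Des-at i)) (trans (read i Des≡) (first-at A i)))
             (trans (sym (Asc-at i)) (trans (read i Asc≡) (last-at B i)))
             (trans (sym (Equ-at i)) (trans (read i Equ≡) (middle-at A B i)))

  forcedA-at : ∀ i → lookup forcedA i ≡ Y₂f π[ i ] σ[ i ] ∧ isDescent (trendAt i)
  forcedA-at i = VecP.lookup∘tabulate _ i

  forcedB-at : ∀ i → lookup forcedB i ≡ Y₃f π[ i ] σ[ i ] ∧ isAscent (trendAt i)
  forcedB-at i = VecP.lookup∘tabulate _ i

  forcedA⊆Y₂ : forcedA ⊆ Y₂ π σ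
  forcedA⊆Y₂ = ≤⇒⊆ (λ i → subst₂ Bool._≤_ (sym (forcedA-at i)) (sym (Y-at Y₂f i)) (∧-≤ˡ _ _))

  forcedB⊆Y₃ : forcedB ⊆ Y₃ π σ
  forcedB⊆Y₃ = ≤⇒⊆ (λ i → subst₂ Bool._≤_ (sym (forcedB-at i)) (sym (Y-at Y₃f i)) (∧-≤ˡ _ _))

  decomposition-complete : InC c → signs ≡ σ → IsDecomposition forcedA forcedB
  decomposition-complete inC signs≡σ =
    inC , Pointwise-≡⇒≡ (ext Des≡) , Pointwise-≡⇒≡ (ext Equ≡) , Pointwise-≡⇒≡ (ext Asc≡)
    where
    sign-at : ∀ i → newSign π[ i ] (trendAt i) ≡ σ[ i ]
    sign-at i = trans (sym (signs-at i)) (cong (λ v → lookup v i) signs≡σ)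
    Des≡ : ∀ i → lookup (Des c) i ≡ lookup (Y₁ π σ ∪ forcedA) i
    Des≡ i = trans (Des-at i)
      (trans (proj₁ (decomposition-at-complete π[ i ] σ[ i ] (trendAt i) (sign-at i)))
             (sym (trans (first-at forcedA i) (cong (Y₁f π[ i ] σ[ i ] ∨_) (forcedA-at i)))))
    Asc≡ : ∀ i → lookup (Asc c) i ≡ lookup (Y₄ π σ ∪ forcedB) i
    Asc≡ i = trans (Asc-at i)
      (trans (proj₁ (proj₂ (decomposition-at-complete π[ i ] σ[ i ] (trendAt i) (sign-at i))))
             (sym (trans (last-at forcedB i) (cong (Y₄f π[ i ] σ[ i ] ∨_) (forcedB-at i)))))
    Equ≡ : ∀ i → lookup (Equ c) i ≡ lookup ((Y₂ π σ ∪ Y₃ π σ) ─ (forcedA ∪ forcedB)) i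
    Equ≡ i = trans (Equ-at i)
      (trans (proj₂ (proj₂ (decomposition-at-complete π[ i ] σ[ i ] (trendAt i) (sign-at i))))
             (sym (trans (middle-at forcedA forcedB i)
                         (cong₂ (λ u v → (Y₂f π[ i ] σ[ i ] ∨ Y₃f π[ i ] σ[ i ]) ∧ not (u ∨ v))
                                (forcedA-at i) (forcedB-at i)))))

  characterisation : InF π σ c ⇔ (∃[ A ] ∃[ B ] (A ⊆ Y₂ π σ × B ⊆ Y₃ π σ × IsDecomposition A B))
  characterisation = mk⇔
    (λ (inC , same) → forcedA , forcedB , forcedA⊆Y₂ , forcedB⊆Y₃ ,
                      decomposition-complete inC (Equivalence.to (reconstruction σ) same))
    (λ (A , B , A⊆Y₂ , B⊆Y₃ , dec) →
       proj₁ dec , Equivalence.from (reconstruction σ) (proj₁ (decomposition-sound A⊆Y₂ B⊆Y₃ dec)))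

_≟ˢ_ : {m : ℕ} → DecidableEquality (Subset m)
_≟ˢ_ = VecP.≡-dec Bool._≟_

∑-allSubsets : ∀ m (u : Subset (suc m) → ℕ) →
  ∑ u (allSubsets (suc m)) ≡ ∑ (u ∘ (true ∷_)) (allSubsets m) + ∑ (u ∘ (false ∷_)) (allSubsets m)
∑-allSubsets m u = begin
  ∑ u (map (true ∷_) (allSubsets m) ++ map (false ∷_) (allSubsets m) ++ [])
    ≡⟨ ∑-++ u (map (true ∷_) (allSubsets m)) _ ⟩
  ∑ u (map (true ∷_) (allSubsets m)) + ∑ u (map (false ∷_) (allSubsets m) ++ [])
    ≡⟨ cong (∑ u (map (true ∷_) (allSubsets m)) +_) (trans (∑-++ u (map (false ∷_) (allSubsets m)) []) (ℕP.+-identityʳ _)) ⟩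
  ∑ u (map (true ∷_) (allSubsets m)) + ∑ u (map (false ∷_) (allSubsets m))
    ≡⟨ cong₂ _+_ (∑-map u (true ∷_) (allSubsets m)) (∑-map u (false ∷_) (allSubsets m)) ⟩
  ∑ (u ∘ (true ∷_)) (allSubsets m) + ∑ (u ∘ (false ∷_)) (allSubsets m) ∎
  where open ≡-Reasoning

occurrences-all : ∀ m (X : Subset m) → ∑ (λ A → 𝟙 (does (A ≟ˢ X))) (allSubsets m) ≡ 1
occurrences-all zero    []          = refl
occurrences-all (suc m) (true  ∷ X) =
  trans (∑-allSubsets m _) (cong₂ _+_ (occurrences-all m X) (∑-zero (allSubsets m) (λ _ _ → refl)))
occurrences-all (suc m) (false ∷ X) =
  trans (∑-allSubsets m _) (cong₂ _+_ (∑-zero (allSubsets m) (λ _ _ → refl)) (occurrences-all m X))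

occurrences-⊆ : ∀ {m} (Y X : Subset m) → X ⊆ Y → ∑ (λ A → 𝟙 (does (A ≟ˢ X))) (filter (_⊆? Y) (allSubsets m)) ≡ 1
occurrences-⊆ {m} Y X X⊆Y = begin
  ∑ (λ A → 𝟙 (does (A ≟ˢ X))) (filter (_⊆? Y) (allSubsets m))
    ≡⟨ ∑-filter (_⊆? Y) _ (allSubsets m) ⟩
  ∑ (λ A → when (does (A ⊆? Y)) (𝟙 (does (A ≟ˢ X)))) (allSubsets m)
    ≡⟨ ∑-cong (allSubsets m) only-X ⟩
  ∑ (λ A → 𝟙 (does (A ≟ˢ X))) (allSubsets m)
    ≡⟨ occurrences-all m X ⟩
  1 ∎
  where
  open ≡-Reasoning
  only-X : ∀ A → when (does (A ⊆? Y)) (𝟙 (does (A ≟ˢ X))) ≡ 𝟙 (does (A ≟ˢ X))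
  only-X A with A ≟ˢ X
  ... | yes refl rewrite dec-true (A ⊆? Y) X⊆Y = refl
  ... | no  _    = when-zero (does (A ⊆? Y))

module Counting {n k : ℕ} (π σ : Vec Sign n) where
  open Decomposition {n} {k} π σ

  subsetsOf₂ subsetsOf₃ : List (Subset n)
  subsetsOf₂ = filter (_⊆? Y₂ π σ) (allSubsets n)
  subsetsOf₃ = filter (_⊆? Y₃ π σ) (allSubsets n)

  ⊆Y₂ : ∀ {A} → A ∈ subsetsOf₂ → A ⊆ Y₂ π σ
  ⊆Y₂ A∈ = proj₂ (∈-filter⁻ (_⊆? Y₂ π σ) {xs = allSubsets n} A∈)

  ⊆Y₃ : ∀ {B} → B ∈ subsetsOf₃ → B ⊆ Y₃ π σ
  ⊆Y₃ B∈ = proj₂ (∈-filter⁻ (_⊆? Y₃ π σ) {xs = allSubsets n} B∈)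

  colourings : List (Vec (Fin k) (suc n))
  colourings = allVecs k (suc n)

  isDecomposition? : ∀ A B (c : Vec (Fin k) (suc n)) → Dec (IsDecomposition c A B)
  isDecomposition? A B c = inWordEuler? (Y₁ π σ ∪ A) ((Y₂ π σ ∪ Y₃ π σ) ─ (A ∪ B)) (Y₄ π σ ∪ B) c

  -- The decision of membership in F is an
  -- argument so that the proof can split on it.
  decompositions : (c : Vec (Fin k) (suc n)) (inF? : Dec (InF π σ c)) →
    ∑ (λ A → ∑ (λ B → 𝟙 (does (isDecomposition? A B c))) subsetsOf₃) subsetsOf₂ ≡ 𝟙 (does inF?)
  decompositions c (no ¬inF) = ∑-zero subsetsOf₂ (λ A A∈ → ∑-zero subsetsOf₃ (λ B B∈ →
                    cong 𝟙 (dec-false (isDecomposition? A B c) (λ dec →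
                      ¬inF (Equivalence.from (characterisation c) (A , B , ⊆Y₂ A∈ , ⊆Y₃ B∈ , dec))))))
  decompositions c (yes (inC , same)) = begin
    ∑ (λ A → ∑ (λ B → 𝟙 (does (isDecomposition? A B c))) subsetsOf₃) subsetsOf₂
      ≡⟨ ∑-cong∈ subsetsOf₂ (λ A A∈ → ∑-cong∈ subsetsOf₃ (λ B B∈ →
           cong 𝟙 (does-⇔ (unique A∈ B∈) (isDecomposition? A B c) ((A ≟ˢ a) ×-dec (B ≟ˢ b))))) ⟩
    ∑ (λ A → ∑ (λ B → 𝟙 (does (A ≟ˢ a) ∧ does (B ≟ˢ b))) subsetsOf₃) subsetsOf₂
      ≡⟨ ∑-cong subsetsOf₂ (λ A → trans (∑-cong subsetsOf₃ (λ B → 𝟙-∧ (does (A ≟ˢ a)) (does (B ≟ˢ b))))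
                                         (∑-when (does (A ≟ˢ a)) (λ B → 𝟙 (does (B ≟ˢ b))) subsetsOf₃)) ⟩
    ∑ (λ A → when (does (A ≟ˢ a)) (∑ (λ B → 𝟙 (does (B ≟ˢ b))) subsetsOf₃)) subsetsOf₂
      ≡⟨ ∑-cong subsetsOf₂ (λ A → cong (when (does (A ≟ˢ a))) (occurrences-⊆ (Y₃ π σ) b (forcedB⊆Y₃ c))) ⟩
    ∑ (λ A → 𝟙 (does (A ≟ˢ a))) subsetsOf₂
      ≡⟨ occurrences-⊆ (Y₂ π σ) a (forcedA⊆Y₂ c) ⟩
    1 ∎
    where
    open ≡-Reasoning
    a b : Subset n
    a = forcedA c
    b = forcedB c
    unique : ∀ {A B} → A ∈ subsetsOf₂ → B ∈ subsetsOf₃ → IsDecomposition c A B ⇔ (A ≡ a × B ≡ b)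
    unique A∈ B∈ = mk⇔ (λ dec → proj₂ (decomposition-sound c (⊆Y₂ A∈) (⊆Y₃ B∈) dec))
                       (λ { (refl , refl) → decomposition-complete c inC
                                              (Equivalence.to (Reconstruction.reconstruction π c σ) same) })

  -- f(D_π , D_σ , k) is the sum of the wordeuler numbers: count the triples (c , A , B).
  counting : f π σ k ≡ sumWE π σ k
  counting = begin
    length (filter (inF? π σ) colourings)
      ≡⟨ length-filter (inF? π σ) colourings ⟩
    ∑ (λ c → 𝟙 (does (inF? π σ c))) colourings
      ≡⟨ ∑-cong colourings (λ c → sym (decompositions c (inF? π σ c))) ⟩
    ∑ (λ c → ∑ (λ A → ∑ (λ B → decomposes A B c) subsetsOf₃) subsetsOf₂) colourings
      ≡⟨ ∑-swap (λ c A → ∑ (λ B → decomposes A B c) subsetsOf₃) colourings subsetsOf₂ ⟩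
    ∑ (λ A → ∑ (λ c → ∑ (λ B → decomposes A B c) subsetsOf₃) colourings) subsetsOf₂
      ≡⟨ ∑-cong subsetsOf₂ (λ A → ∑-swap (λ c B → decomposes A B c) colourings subsetsOf₃) ⟩
    ∑ (λ A → ∑ (λ B → ∑ (decomposes A B) colourings) subsetsOf₃) subsetsOf₂
      ≡⟨ ∑-cong subsetsOf₂ (λ A → ∑-cong subsetsOf₃ (λ B → sym (length-filter (isDecomposition? A B) colourings))) ⟩
    ∑ (λ A → ∑ (λ B → length (filter (isDecomposition? A B) colourings)) subsetsOf₃) subsetsOf₂
      ≡⟨ sym (sum-cartesianProductWith _ subsetsOf₂ subsetsOf₃) ⟩
    sumWE π σ k ∎
    where
    open ≡-Reasoning
    decomposes : Subset n → Subset n → Vec (Fin k) (suc n) → ℕ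
    decomposes A B c = 𝟙 (does (isDecomposition? A B c))

-- Theorem 7.1.
theorem7p1 : (n k : ℕ) → 1 ≤ n → 1 ≤ k → (π σ : Vec Sign n) →
    ((c : Vec (Fin k) (suc n)) →
      InF π σ c ⇔
      (∃[ A ] ∃[ B ] (A ⊆ Y₂ π σ × B ⊆ Y₃ π σ ×
        InWordEuler (Y₁ π σ ∪ A) ((Y₂ π σ ∪ Y₃ π σ) ─ (A ∪ B)) (Y₄ π σ ∪ B) c)))
    × f π σ k ≡ sumWE π σ k
theorem7p1 n k _ _ π σ = Decomposition.characterisation π σ , Counting.counting {n} {k} π σ
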